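{- Let $\mathbf{G}=\mathbf{GSp}_{2r}$ (split) over $S$, where $S$'s residue fields all contain exactly two square roots of unity, and let $\tilde{\mathbf{G}}$ be a degree $2$ cover of $\mathbf{G}$ with first Brylinski–Deligne invariant $Q_{0,1}$. Then the dual group $\tilde{\mathbb{G}}^\vee$ is isomorphic to $\mathbb{GSp}_{2r}$ if $r$ is odd, and to $\mathbb{PGSp}_{2r}\times\mathbb{G}_m$ if $r$ is even.
   Context: $S$ is $\operatorname{Spec}$ of a field or of a DVR (containing a field or with finite residue field). For the standard split maximal torus and Borel subgroup of $\mathbf{GSp}_{2r}$, let $e_0,\dots,e_r$ be a basis of the cocharacter lattice $Y$ and $f_0,\dots,f_r$ the dual basis of $X$; the simple roots are $f_1-f_2,\dots,f_{r-1}-f_r,2f_r-f_0$ with simple coroots $e_1-e_2,\dots,e_{r-1}-e_r,e_r$. The Weyl group $S_r\ltimes\mu_2^r$ acts with $S_r$ permuting indices $1,\dots,r$ and elements $w_j$ with $w_j(e_j)=-e_j$, $w_j(e_i)=e_i$ ($i\ne j,0$), $w_j(e_0)=e_0+e_j$. For integers $\kappa,\nu$, $Q_{\kappa,\nu}$ is the unique Weyl-invariant quadratic form on $Y$ with $Q(e_0)=\kappa$ and $Q(e_i)=\nu$ for $1\le i\le r$. A degree $2$ cover is a Brylinski–Deligne central extension of $\mathbf{G}$ by $\mathbf{K}_2$ with $n=2$. The dual group is the pinned split reductive group over $\mathbb{Z}$ with based root datum $(Y_{Q,n},\tilde\Phi^\vee,\tilde\Delta^\vee,X_{Q,n},\tilde\Phi,\tilde\Delta)$,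 where $\beta_Q(y_1,y_2)=n^{ -1}(Q(y_1+y_2)-Q(y_1)-Q(y_2))$, $Y_{Q,n}=\{y:\beta_Q(y,Y)\subset\mathbb{Z}\}$, $X_{Q,n}=\{x\in n^{ -1}X:\langle x,Y_{Q,n}\rangle\subset\mathbb{Z}\}$, and $n_\phi=n/\gcd(n,Q(\phi^\vee))$, $\tilde\phi=n_\phi^{ -1}\phi$, $\tilde\phi^\vee=n_\phi\phi^\vee$. -}

module Defs where

open import Data.Nat as ℕ using (ℕ; zero; suc; NonZero; _≡ᵇ_)
open import Data.Nat.GCD using (gcd; gcd[m,n]≡0⇒m≡0)
open import Data.Nat.DivMod using (_/_)
open import Data.Integer as ℤ using (ℤ; +_; _+_; _-_; _*_; -_; ∣_∣)
open import Data.Integer.Divisibility using (_∣_)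
open import Data.Fin using (Fin; zero; suc; toℕ)
open import Data.Bool using (Bool; if_then_else_; _∧_)
open import Data.Product using (Σ; ∃; _×_; _,_)
open import Data.Unit using (⊤)
open import Data.Empty using (⊥)
open import Function.Bundles using (_↔_; Inverse)
open import Relation.Binary.PropositionalEquality using (_≡_; _≢_; _≗_)

Vecℤ : ℕ → Set
Vecℤ m = Fin m → ℤ

sumℤ : ∀ {k} → Vecℤ k → ℤ
sumℤ {zero}  v = + 0
sumℤ {suc k} v = v zero + sumℤ (λ i → v (suc i))

_⊕_ : ∀ {m} → Vecℤ m → Vecℤ m → Vecℤ m
(u ⊕ v) i = u i + v i

_•_ : ∀ {m} → ℤ → Vecℤ m → Vecℤ m
(c • v) i = c * v i

-- the standard pairing  ⟨ x , y ⟩ = Σ x_i y_i  (X × Y → ℤ in dual bases)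
⟨_,_⟩ : ∀ {m} → Vecℤ m → Vecℤ m → ℤ
⟨ u , v ⟩ = sumℤ (λ i → u i * v i)

-- The character lattice X is a sublattice of an ambient ℤ^m, given by a
-- predicate.  The cocharacter lattice is Hom(X,ℤ) (perfect pairing), so a
-- simple coroot is recorded as the functional  x ↦ ⟨ num , x ⟩ / den
-- (a rational vector num/den of ℚ^m restricted to X).

record BasedRootDatum : Set₁ where
  field
    ambient      : ℕ
    rank         : ℕ                       -- number of simple roots
    X            : Vecℤ ambient → Set
    simpleRoot   : Fin rank → Vecℤ ambient
    corootNum    : Fin rank → Vecℤ ambient
    corootDen    : Fin rank → ℕ

open BasedRootDatum public

-- By the isomorphism theorem for pinned split reductive groups over ℤ, two
-- such groups are isomorphic iff their based root data are.
record RootDatumIso (D E : BasedRootDatum) : Set where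
  field
    φ        : Vecℤ (ambient D) → Vecℤ (ambient E)
    σ        : Fin (rank D) ↔ Fin (rank E)
    φ-into   : ∀ x → X D x → X E (φ x)
    φ-add    : ∀ x y → X D x → X D y → φ (x ⊕ y) ≗ (φ x ⊕ φ y)
    φ-inj    : ∀ x y → X D x → X D y → φ x ≗ φ y → x ≗ y
    φ-surj   : ∀ x′ → X E x′ → Σ (Vecℤ (ambient D)) (λ x → X D x × (φ x ≗ x′))
    roots    : ∀ i → φ (simpleRoot D i) ≗ simpleRoot E (Inverse.to σ i)
    coroots  : ∀ i x → X D x →
               (+ corootDen D i) * ⟨ corootNum E (Inverse.to σ i) , φ x ⟩
                 ≡ (+ corootDen E (Inverse.to σ i)) * ⟨ corootNum D i , x ⟩

_≅_ : BasedRootDatum → BasedRootDatum → Set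
D ≅ E = RootDatumIso D E

-- GSp_{2r}: X = ℤ f_0 ⊕ … ⊕ ℤ f_r, Y = ℤ e_0 ⊕ … ⊕ ℤ e_r  (index 0 ↔ f_0,e_0).
-- Simple root i (i = 0,…,r-1, paper's index i+1):
--   f_{i+1} - f_{i+2}  if i+1 < r,      2 f_r - f_0  if i+1 = r.
-- Simple coroot i:
--   e_{i+1} - e_{i+2}  if i+1 < r,      e_r          if i+1 = r.

isLast : (r : ℕ) → Fin r → Bool
isLast r i = suc (toℕ i) ≡ᵇ r

gspRoot : (r : ℕ) → Fin r → Vecℤ (suc r)
gspRoot r i j =
  if toℕ j ≡ᵇ 0 then (if isLast r i then - (+ 1) else + 0)
  else if toℕ j ≡ᵇ suc (toℕ i) then (if isLast r i then + 2 else + 1)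
  else if toℕ j ≡ᵇ suc (suc (toℕ i)) then - (+ 1)
  else + 0

gspCoroot : (r : ℕ) → Fin r → Vecℤ (suc r)
gspCoroot r i j =
  if toℕ j ≡ᵇ suc (toℕ i) then + 1
  else if toℕ j ≡ᵇ suc (suc (toℕ i)) then - (+ 1)
  else + 0

GSpDatum : ℕ → BasedRootDatum
GSpDatum r = record
  { ambient = suc r ; rank = r ; X = λ _ → ⊤
  ; simpleRoot = gspRoot r ; corootNum = gspCoroot r ; corootDen = λ _ → 1 }

-- PGSp_{2r} = GSp_{2r} / Z with Z the centre, whose
-- cocharacter is z = 2 e_0 + e_1 + … + e_r (scalars t: f_0 ↦ t², f_i ↦ t).
-- Its character lattice is {x ∈ X : ⟨x,z⟩ = 0}, cocharacters Y/ℤz, roots and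
-- coroots induced from GSp_{2r}.  The G_m factor contributes ℤ (no roots);
-- we put it in ambient coordinate 0 and the GSp coordinates in suc j.

centralCochar : (r : ℕ) → Vecℤ (suc r)
centralCochar r zero    = + 2
centralCochar r (suc j) = + 1

extGm : ∀ {r} → Vecℤ (suc r) → Vecℤ (suc (suc r))
extGm v zero    = + 0
extGm v (suc j) = v j

PGSpGmDatum : ℕ → BasedRootDatum
PGSpGmDatum r = record
  { ambient = suc (suc r) ; rank = r
  ; X = λ x → ⟨ (λ j → x (suc j)) , centralCochar r ⟩ ≡ + 0
  ; simpleRoot = λ i → extGm (gspRoot r i)
  ; corootNum = λ i → extGm (gspCoroot r i)
  ; corootDen = λ _ → 1 }

-- The quadratic form Q_{κ,ν} on Y = ℤ^{r+1}: the unique Weyl-invariant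
-- quadratic form with Q(e_0) = κ, Q(e_i) = ν.  Explicitly
--   Q(y) = κ y_0² + ν Σ_{i≥1} y_i² - ν y_0 Σ_{i≥1} y_i .
Qform : (κ ν : ℤ) (r : ℕ) → Vecℤ (suc r) → ℤ
Qform κ ν r y =
  κ * (y zero * y zero)
  + ν * sumℤ (λ i → y (suc i) * y (suc i))
  - ν * (y zero * sumℤ (λ i → y (suc i)))

nβ : ∀ {m} → (Vecℤ m → ℤ) → Vecℤ m → Vecℤ m → ℤ
nβ Q y₁ y₂ = Q (y₁ ⊕ y₂) - Q y₁ - Q y₂

-- Y_{Q,n} = { y ∈ Y : β_Q(y, Y) ⊆ ℤ }
YQn : ∀ {m} → (Vecℤ m → ℤ) → ℕ → Vecℤ m → Set
YQn Q n y = ∀ y′ → (+ n) ∣ nβ Q y y′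

gcd-nonZero : (n q : ℕ) → .{{NonZero n}} → NonZero (gcd n q)
gcd-nonZero (suc n) q = ℕ.≢-nonZero (λ e → help (gcd[m,n]≡0⇒m≡0 {suc n} {q} e))
  where
  help : suc n ≡ 0 → ⊥
  help ()

nφ : (n : ℕ) → .{{NonZero n}} → ℤ → ℕ
nφ n q = _/_ n (gcd n ∣ q ∣) {{gcd-nonZero n ∣ q ∣}}

-- The dual group of a degree-n cover of GSp_{2r} with invariant Q_{κ,ν}:
-- based root datum (Y_{Q,n}, Φ̃^∨, X_{Q,n}, Φ̃) with simple roots
-- α̃_i^∨ = n_α α_i^∨ ∈ Y_{Q,n} and simple coroots α̃_i = n_α^{-1} α_i,
-- the latter as functional on Y_{Q,n} (X_{Q,n} = Hom(Y_{Q,n},ℤ)).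
DualDatum : (κ ν : ℤ) (n : ℕ) → .{{NonZero n}} → ℕ → BasedRootDatum
DualDatum κ ν n r = record
  { ambient = suc r ; rank = r
  ; X = YQn (Qform κ ν r) n
  ; simpleRoot = λ i → (+ nφ n (Qform κ ν r (gspCoroot r i))) • gspCoroot r i
  ; corootNum = gspRoot r
  ; corootDen = λ i → nφ n (Qform κ ν r (gspCoroot r i)) }

module Submission where

-- For Q_{0,1} one computes n·β_Q(x,y) = 2Σ_{i≥1} x_i y_i − (x_0 Σy + y_0 Σx), so
-- Y_{Q,2} = { x : x_0 and Σ_{i≥1} x_i are even }.  Q(α^∨) is 2 on the short
-- coroots and 1 on e_r, so the dual simple roots are α_i^∨ (i < r) and 2e_r.
-- Writing r = 2m + ε, the map
--   φ(x) = (m·x_0/2 − Σ_{i≥1} x_i/2 , x_1 − x_0/2 , … , x_r − x_0/2)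
-- sends these to the simple roots of GSp_{2r}, is compatible with coroots, and
-- satisfies ⟨φ(x), z⟩ = (2m − r)·x_0/2 for the central cocharacter z.  If r is
-- odd this pairing recovers x_0/2, so φ is bijective onto ℤ^{1+r}; if r is even
-- φ lands in z^⊥ = X(PGSp_{2r}) and x ↦ (x_0/2, φ(x)) is bijective onto X(PGSp × G_m).

open import Defs
open import Data.Nat using (ℕ; _≤_; _%_)
open import Data.Integer using (+_)
open import Data.Product using (_×_)
open import Relation.Binary.PropositionalEquality using (_≡_)

open import Data.Nat as ℕ using (zero; suc; _<_; _≡ᵇ_; s≤s)
import Data.Nat.Properties as ℕP
open import Data.Nat.DivMod using (m≡m%n+[m/n]*n) renaming (_/_ to _div_)
open import Data.Integer using (ℤ; -[1+_]; _+_; _-_; _*_; -_)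
import Data.Integer.Properties as ℤP
open import Data.Integer.Tactic.RingSolver using (solve-∀)
open import Data.Integer.Divisibility using () renaming (_∣_ to _∣ᵤ_)
open import Data.Integer.Divisibility.Signed using (divides; ∣ᵤ⇒∣; ∣⇒∣ᵤ)
open import Data.Fin using (Fin; toℕ) renaming (zero to fz; suc to fs)
open import Data.Fin.Properties using (toℕ<n)
open import Data.Bool using (Bool; true; false; if_then_else_; T)
open import Data.Product using (Σ; _,_; proj₁; proj₂)
open import Data.Unit using (tt)
open import Function.Bundles using (_↔_; Inverse)
open import Function.Construct.Identity using (↔-id)
open import Relation.Binary.PropositionalEquality
  using (refl; sym; trans; cong; cong₂; subst; _≗_; module ≡-Reasoning)

tl : ∀ {m} → Vecℤ (suc m) → Vecℤ m
tl v i = v (fs i)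

sumTail : ∀ {m} → Vecℤ (suc m) → ℤ
sumTail v = sumℤ (tl v)

sum-cong : ∀ {k} {f g : Vecℤ k} → f ≗ g → sumℤ f ≡ sumℤ g
sum-cong {zero}  e = refl
sum-cong {suc k} e = cong₂ _+_ (e fz) (sum-cong (λ i → e (fs i)))

sum-⊕ : ∀ {k} (f g : Vecℤ k) → sumℤ (f ⊕ g) ≡ sumℤ f + sumℤ g
sum-⊕ {zero}  f g = refl
sum-⊕ {suc k} f g = trans (cong (_+_ (f fz + g fz)) (sum-⊕ (tl f) (tl g))) (swap (f fz) (g fz) _ _)
  where
  swap : ∀ a b c d → (a + b) + (c + d) ≡ (a + c) + (b + d)
  swap = solve-∀

sum-• : ∀ {k} c (f : Vecℤ k) → sumℤ (c • f) ≡ c * sumℤ f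
sum-• {zero}  c f = sym (ℤP.*-zeroʳ c)
sum-• {suc k} c f = trans (cong (_+_ (c * f fz)) (sum-• c (tl f))) (sym (ℤP.*-distribˡ-+ c (f fz) _))

sum-const : ∀ {k} c → sumℤ {k} (λ _ → c) ≡ + k * c
sum-const {zero}  c = refl
sum-const {suc k} c = trans (cong (_+_ c) (sum-const {k} c)) (succ c (+ k))
  where
  succ : ∀ c k → c + k * c ≡ (+ 1 + k) * c
  succ = solve-∀

sum-zero : ∀ {k} → sumℤ {k} (λ _ → + 0) ≡ + 0
sum-zero {k} = trans (sum-const {k} (+ 0)) (ℤP.*-zeroʳ (+ k))

sum-shift : ∀ {k} (w : Vecℤ k) d → sumℤ (λ j → w j + d) ≡ sumℤ w + + k * d
sum-shift {k} w d = trans (sum-⊕ w (λ _ → d)) (cong (_+_ (sumℤ w)) (sum-const {k} d))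

-- coord k w is the k-th coordinate of w, read as 0 when k is out of range
-- (this is the convention y_{r+1} = 0 that makes all simple roots look alike).
coord : ∀ {m} → ℕ → Vecℤ m → ℤ
coord {zero}  k       w = + 0
coord {suc m} zero    w = w fz
coord {suc m} (suc k) w = coord k (tl w)

coord-tabulate : ∀ {m} k (F : ℕ → ℤ) → k < m → coord {m} k (λ j → F (toℕ j)) ≡ F k
coord-tabulate {suc m} zero    F _         = refl
coord-tabulate {suc m} (suc k) F (s≤s k<m) = coord-tabulate k (λ t → F (suc t)) k<m

coord-out : ∀ {m} k (w : Vecℤ m) → m ≤ k → coord k w ≡ + 0
coord-out {zero}  k       w _         = refl
coord-out {suc m} (suc k) w (s≤s m≤k) = coord-out k (tl w) m≤k

coord-shift : ∀ {m} k (w : Vecℤ m) d → k < m → coord k (λ j → w j + d) ≡ coord k w + d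
coord-shift {suc m} zero    w d _         = refl
coord-shift {suc m} (suc k) w d (s≤s k<m) = coord-shift k (tl w) d k<m

pair-update : ∀ {m} k a (F : ℕ → ℤ) (w : Vecℤ m) →
  ⟨ (λ j → if toℕ j ≡ᵇ k then a else F (toℕ j)) , w ⟩
    ≡ ⟨ (λ j → F (toℕ j)) , w ⟩ + (a - F k) * coord k w
pair-update {zero}  k       a F w = sym (trans (ℤP.+-identityˡ _) (ℤP.*-zeroʳ (a - F k)))
pair-update {suc m} zero    a F w = head (w fz) a (F 0) _
  where
  head : ∀ w₀ a f s → a * w₀ + s ≡ (f * w₀ + s) + (a - f) * w₀
  head = solve-∀
pair-update {suc m} (suc k) a F w =
  trans (cong (_+_ (F 0 * w fz)) (pair-update k a (λ t → F (suc t)) (tl w))) (sym (ℤP.+-assoc (F 0 * w fz) _ _))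

≡ᵇ-refl : ∀ n → (n ≡ᵇ n) ≡ true
≡ᵇ-refl zero    = refl
≡ᵇ-refl (suc n) = ≡ᵇ-refl n

≡ᵇ-suc : ∀ n → (n ≡ᵇ suc n) ≡ false
≡ᵇ-suc zero    = refl
≡ᵇ-suc (suc n) = ≡ᵇ-suc n

suc-≡ᵇ : ∀ n → (suc n ≡ᵇ n) ≡ false
suc-≡ᵇ zero    = refl
suc-≡ᵇ (suc n) = suc-≡ᵇ n

-- step a k = a·ε_k − ε_{k+1}: the coordinates 1,…,r of every simple root and
-- simple coroot of GSp_{2r} have this shape.
stepAt : ℤ → ℕ → ℕ → ℤ
stepAt a k t = if t ≡ᵇ k then a else if t ≡ᵇ suc k then - (+ 1) else + 0

step : ∀ {m} → ℤ → ℕ → Vecℤ m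
step a k j = stepAt a k (toℕ j)

pair-step : ∀ {m} a k (w : Vecℤ m) → ⟨ step a k , w ⟩ ≡ a * coord k w - coord (suc k) w
pair-step {m} a k w = begin
  ⟨ step a k , w ⟩
    ≡⟨ pair-update k a F w ⟩
  ⟨ (λ j → F (toℕ j)) , w ⟩ + (a - F k) * coord k w
    ≡⟨ cong₂ (λ s f → s + (a - f) * coord k w) (pair-update (suc k) (- (+ 1)) (λ _ → + 0) w) (Fk k) ⟩
  (sumℤ {m} (λ _ → + 0) + (- (+ 1) - + 0) * coord (suc k) w) + (a - + 0) * coord k w
    ≡⟨ cong (λ s → (s + (- (+ 1) - + 0) * coord (suc k) w) + (a - + 0) * coord k w) (sum-zero {m}) ⟩
  (+ 0 + (- (+ 1) - + 0) * coord (suc k) w) + (a - + 0) * coord k w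
    ≡⟨ simplify a (coord k w) (coord (suc k) w) ⟩
  a * coord k w - coord (suc k) w ∎
  where
  open ≡-Reasoning
  F : ℕ → ℤ
  F t = if t ≡ᵇ suc k then - (+ 1) else + 0
  Fk : ∀ k → (if k ≡ᵇ suc k then - (+ 1) else + 0) ≡ + 0
  Fk k rewrite ≡ᵇ-suc k = refl
  simplify : ∀ a u v → (+ 0 + (- (+ 1) - + 0) * v) + (a - + 0) * u ≡ a * u - v
  simplify = solve-∀

isLast-cases : ∀ r (i : Fin r) (P : Bool → Set) →
  (suc (toℕ i) ≡ r → P true) → (suc (toℕ i) < r → P false) → P (isLast r i)
isLast-cases r i P last notLast with isLast r i in eq
... | true  = last (ℕP.≡ᵇ⇒≡ (suc (toℕ i)) r (subst T (sym eq) tt))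
... | false = notLast (ℕP.≤∧≢⇒< (toℕ<n i) (λ e → subst T eq (ℕP.≡⇒≡ᵇ (suc (toℕ i)) r e)))

coord-next : ∀ r (i : Fin r) (F : ℕ → ℤ) →
  coord {r} (suc (toℕ i)) (λ j → F (toℕ j)) ≡ (if isLast r i then + 0 else F (suc (toℕ i)))
coord-next r i F =
  isLast-cases r i (λ b → coord {r} (suc (toℕ i)) (λ j → F (toℕ j)) ≡ (if b then + 0 else F (suc (toℕ i))))
    (λ e → coord-out (suc (toℕ i)) _ (ℕP.≤-reflexive (sym e)))
    (coord-tabulate (suc (toℕ i)) F)

coord-step : ∀ r (i : Fin r) a → coord (toℕ i) (step {r} a (toℕ i)) ≡ a
coord-step r i a = trans (coord-tabulate (toℕ i) (stepAt a (toℕ i)) (toℕ<n i)) (here (toℕ i))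
  where
  here : ∀ k → (if k ≡ᵇ k then a else if k ≡ᵇ suc k then - (+ 1) else + 0) ≡ a
  here k rewrite ≡ᵇ-refl k = refl

coord-step-next : ∀ r (i : Fin r) a →
  coord (suc (toℕ i)) (step {r} a (toℕ i)) ≡ (if isLast r i then + 0 else - (+ 1))
coord-step-next r i a = trans (coord-next r i (stepAt a (toℕ i))) (cong (if isLast r i then + 0 else_) (next (toℕ i)))
  where
  next : ∀ k → (if suc k ≡ᵇ k then a else if suc k ≡ᵇ suc k then - (+ 1) else + 0) ≡ - (+ 1)
  next k rewrite suc-≡ᵇ k | ≡ᵇ-refl k = refl

coroot-pairing : ∀ r (i : Fin r) (w : Vecℤ (suc r)) →
  ⟨ gspCoroot r i , w ⟩ ≡ coord (toℕ i) (tl w) - coord (suc (toℕ i)) (tl w)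
coroot-pairing r i w =
  trans (ℤP.+-identityˡ _)
    (trans (pair-step (+ 1) (toℕ i) (tl w)) (cong (_- coord (suc (toℕ i)) (tl w)) (ℤP.*-identityˡ (coord (toℕ i) (tl w)))))

root-pairing : ∀ r (i : Fin r) (x : Vecℤ (suc r)) →
  ⟨ gspRoot r i , x ⟩
    ≡ (if isLast r i then - (+ 1) else + 0) * x fz
      + ((if isLast r i then + 2 else + 1) * coord (toℕ i) (tl x) - coord (suc (toℕ i)) (tl x))
root-pairing r i x = cong (_+_ ((if isLast r i then - (+ 1) else + 0) * x fz)) (pair-step (if isLast r i then + 2 else + 1) (toℕ i) (tl x))

sumTail-coroot : ∀ r (i : Fin r) → sumTail (gspCoroot r i) ≡ (if isLast r i then + 1 else + 0)
sumTail-coroot r i = begin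
  sumTail (gspCoroot r i)
    ≡⟨ sum-cong {r} (λ j → sym (ℤP.*-identityʳ (step (+ 1) (toℕ i) j))) ⟩
  ⟨ step (+ 1) (toℕ i) , ones ⟩
    ≡⟨ pair-step (+ 1) (toℕ i) ones ⟩
  + 1 * coord (toℕ i) ones - coord (suc (toℕ i)) ones
    ≡⟨ cong₂ (λ u v → + 1 * u - v) (coord-tabulate (toℕ i) (λ _ → + 1) (toℕ<n i)) (coord-next r i (λ _ → + 1)) ⟩
  + 1 * + 1 - (if isLast r i then + 0 else + 1)
    ≡⟨ evaluate (isLast r i) ⟩
  (if isLast r i then + 1 else + 0) ∎
  where
  open ≡-Reasoning
  ones : Vecℤ r
  ones _ = + 1
  evaluate : ∀ b → + 1 * + 1 - (if b then + 0 else + 1) ≡ (if b then + 1 else + 0)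
  evaluate true  = refl
  evaluate false = refl

Q₀₁ : (r : ℕ) → Vecℤ (suc r) → ℤ
Q₀₁ = Qform (+ 0) (+ 1)

Q-coroot : ∀ r (i : Fin r) → Q₀₁ r (gspCoroot r i) ≡ (if isLast r i then + 1 else + 2)
Q-coroot r i = begin
  Q₀₁ r (gspCoroot r i)
    ≡⟨ only-squares ⟨ c , c ⟩ (sumTail (gspCoroot r i)) ⟩
  ⟨ c , c ⟩
    ≡⟨ pair-step (+ 1) (toℕ i) c ⟩
  + 1 * coord (toℕ i) c - coord (suc (toℕ i)) c
    ≡⟨ cong₂ (λ u v → + 1 * u - v) (coord-step r i (+ 1)) (coord-step-next r i (+ 1)) ⟩
  + 1 * + 1 - (if isLast r i then + 0 else - (+ 1))
    ≡⟨ evaluate (isLast r i) ⟩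
  (if isLast r i then + 1 else + 2) ∎
  where
  open ≡-Reasoning
  c : Vecℤ r
  c = step (+ 1) (toℕ i)
  only-squares : ∀ s t → + 0 * (+ 0 * + 0) + + 1 * s - + 1 * (+ 0 * t) ≡ s
  only-squares = solve-∀
  evaluate : ∀ b → + 1 * + 1 - (if b then + 0 else - (+ 1)) ≡ (if b then + 1 else + 2)
  evaluate true  = refl
  evaluate false = refl

nα : ∀ r → Fin r → ℕ
nα r i = nφ 2 (Q₀₁ r (gspCoroot r i))

scale : ∀ r (i : Fin r) → nα r i ≡ (if isLast r i then 2 else 1)
scale r i = trans (cong (nφ 2) (Q-coroot r i)) (evaluate (isLast r i))
  where
  evaluate : ∀ b → nφ 2 (if b then + 1 else + 2) ≡ (if b then 2 else 1)
  evaluate true  = refl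
  evaluate false = refl

pair-square-⊕ : ∀ {k} (u v : Vecℤ k) → ⟨ u ⊕ v , u ⊕ v ⟩ ≡ ⟨ u , u ⟩ + (⟨ v , v ⟩ + + 2 * ⟨ u , v ⟩)
pair-square-⊕ {k} u v = begin
  ⟨ u ⊕ v , u ⊕ v ⟩
    ≡⟨ sum-cong (λ i → expand (u i) (v i)) ⟩
  sumℤ (uu ⊕ (vv ⊕ ((+ 2) • uv)))
    ≡⟨ sum-⊕ uu _ ⟩
  ⟨ u , u ⟩ + sumℤ (vv ⊕ ((+ 2) • uv))
    ≡⟨ cong (_+_ ⟨ u , u ⟩) (trans (sum-⊕ vv _) (cong (_+_ ⟨ v , v ⟩) (sum-• (+ 2) uv))) ⟩
  ⟨ u , u ⟩ + (⟨ v , v ⟩ + + 2 * ⟨ u , v ⟩) ∎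
  where
  open ≡-Reasoning
  uu vv uv : Vecℤ k
  uu i = u i * u i
  vv i = v i * v i
  uv i = u i * v i
  expand : ∀ a b → (a + b) * (a + b) ≡ a * a + (b * b + + 2 * (a * b))
  expand = solve-∀

nβ-Q₀₁ : ∀ r (x y : Vecℤ (suc r)) →
  nβ (Q₀₁ r) x y ≡ + 2 * ⟨ tl x , tl y ⟩ - (x fz * sumTail y + y fz * sumTail x)
nβ-Q₀₁ r x y =
  trans (cong₂ difference (pair-square-⊕ (tl x) (tl y)) (sum-⊕ (tl x) (tl y)))
    (collect (x fz) (y fz) ⟨ tl x , tl x ⟩ ⟨ tl y , tl y ⟩ ⟨ tl x , tl y ⟩ (sumTail x) (sumTail y))
  where
  difference : ℤ → ℤ → ℤ
  difference sq s =
    (+ 0 * ((x fz + y fz) * (x fz + y fz)) + + 1 * sq - + 1 * ((x fz + y fz) * s)) - Q₀₁ r x - Q₀₁ r y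
  collect : ∀ x₀ y₀ qx qy p sx sy →
    (+ 0 * ((x₀ + y₀) * (x₀ + y₀)) + + 1 * (qx + (qy + + 2 * p)) - + 1 * ((x₀ + y₀) * (sx + sy)))
      - (+ 0 * (x₀ * x₀) + + 1 * qx - + 1 * (x₀ * sx))
      - (+ 0 * (y₀ * y₀) + + 1 * qy - + 1 * (y₀ * sy))
    ≡ + 2 * p - (x₀ * sy + y₀ * sx)
  collect = solve-∀

Even : ℤ → Set
Even z = Σ ℤ (λ c → z ≡ c + c)

2∣⇒Even : ∀ {z} → + 2 ∣ᵤ z → Even z
2∣⇒Even 2∣z with ∣ᵤ⇒∣ 2∣z
... | divides c z≡c*2 = c , trans z≡c*2 (twice c)
  where
  twice : ∀ c → c * + 2 ≡ c + c
  twice = solve-∀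

Even⇒2∣ : ∀ {z} → Even z → + 2 ∣ᵤ z
Even⇒2∣ (c , z≡c+c) = ∣⇒∣ᵤ (divides c (trans z≡c+c (twice c)))
  where
  twice : ∀ c → c + c ≡ c * + 2
  twice = solve-∀

Y₂ : ∀ {r} → Vecℤ (suc r) → Set
Y₂ x = Even (x fz) × Even (sumTail x)

e₀ : ∀ {r} → Vecℤ (suc r)
e₀ fz     = + 1
e₀ (fs _) = + 0

e₁ : ∀ {r} → Vecℤ (suc (suc r))
e₁ fz          = + 0
e₁ (fs fz)     = + 1
e₁ (fs (fs _)) = + 0

-- Testing β_Q(x,−) on e_0 gives −Σ_{i≥1} x_i, on e_1 it gives 2x_1 − x_0.
YQ2⇒Y₂ : ∀ r (x : Vecℤ (suc (suc r))) → YQn (Q₀₁ (suc r)) 2 x → Y₂ x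
YQ2⇒Y₂ r x x∈Y = even-x₀ , even-Σ
  where
  zeros : ∀ {k} (v : Vecℤ k) → ⟨ v , (λ _ → + 0) ⟩ ≡ + 0
  zeros {k} v = trans (sum-cong (λ i → ℤP.*-zeroʳ (v i))) (sum-zero {k})
  test-e₀ : nβ (Q₀₁ (suc r)) x e₀ ≡ - sumTail x
  test-e₀ = trans (nβ-Q₀₁ (suc r) x e₀) (evaluate (x fz) (sumTail x) _ _ (zeros (tl x)) (sum-zero {suc r}))
    where
    evaluate : ∀ x₀ s p t → p ≡ + 0 → t ≡ + 0 → + 2 * p - (x₀ * t + + 1 * s) ≡ - s
    evaluate x₀ s p t refl refl = simplify x₀ s
      where
      simplify : ∀ x₀ s → + 2 * + 0 - (x₀ * + 0 + + 1 * s) ≡ - s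
      simplify = solve-∀
  test-e₁ : nβ (Q₀₁ (suc r)) x e₁ ≡ + 2 * x (fs fz) - x fz
  test-e₁ = trans (nβ-Q₀₁ (suc r) x e₁)
    (evaluate (x fz) (x (fs fz)) (sumTail x) _ _ (zeros (λ i → x (fs (fs i)))) (sum-zero {r}))
    where
    evaluate : ∀ x₀ x₁ s p t → p ≡ + 0 → t ≡ + 0 →
      + 2 * (x₁ * + 1 + p) - (x₀ * (+ 1 + t) + + 0 * s) ≡ + 2 * x₁ - x₀
    evaluate x₀ x₁ s p t refl refl = simplify x₀ x₁ s
      where
      simplify : ∀ x₀ x₁ s → + 2 * (x₁ * + 1 + + 0) - (x₀ * (+ 1 + + 0) + + 0 * s) ≡ + 2 * x₁ - x₀
      simplify = solve-∀
  even-Σ : Even (sumTail x)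
  even-Σ with 2∣⇒Even (subst (+ 2 ∣ᵤ_) test-e₀ (x∈Y e₀))
  ... | c , -Σ≡c+c = - c , trans (sym (ℤP.neg-involutive _)) (trans (cong -_ -Σ≡c+c) (negate c))
    where
    negate : ∀ c → - (c + c) ≡ - c + - c
    negate = solve-∀
  even-x₀ : Even (x fz)
  even-x₀ with 2∣⇒Even (subst (+ 2 ∣ᵤ_) test-e₁ (x∈Y e₁))
  ... | c , d≡c+c = x (fs fz) - c , (begin
    x fz                                  ≡⟨ solve-for (x fz) (x (fs fz)) ⟩
    + 2 * x (fs fz) - (+ 2 * x (fs fz) - x fz) ≡⟨ cong (λ d → + 2 * x (fs fz) - d) d≡c+c ⟩
    + 2 * x (fs fz) - (c + c)             ≡⟨ halve (x (fs fz)) c ⟩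
    (x (fs fz) - c) + (x (fs fz) - c)     ∎)
    where
    open ≡-Reasoning
    solve-for : ∀ x₀ x₁ → x₀ ≡ + 2 * x₁ - (+ 2 * x₁ - x₀)
    solve-for = solve-∀
    halve : ∀ x₁ c → + 2 * x₁ - (c + c) ≡ (x₁ - c) + (x₁ - c)
    halve = solve-∀

Y₂⇒YQ2 : ∀ r (x : Vecℤ (suc r)) → Y₂ x → YQn (Q₀₁ r) 2 x
Y₂⇒YQ2 r x ((c , x₀≡c+c) , (s , Σ≡s+s)) y = Even⇒2∣ (t , (begin
  nβ (Q₀₁ r) x y
    ≡⟨ nβ-Q₀₁ r x y ⟩
  + 2 * ⟨ tl x , tl y ⟩ - (x fz * sumTail y + y fz * sumTail x)
    ≡⟨ cong₂ (λ a b → + 2 * ⟨ tl x , tl y ⟩ - (a * sumTail y + y fz * b)) x₀≡c+c Σ≡s+s ⟩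
  + 2 * ⟨ tl x , tl y ⟩ - ((c + c) * sumTail y + y fz * (s + s))
    ≡⟨ factor ⟨ tl x , tl y ⟩ (sumTail y) (y fz) c s ⟩
  t + t ∎))
  where
  open ≡-Reasoning
  t = ⟨ tl x , tl y ⟩ - (c * sumTail y + y fz * s)
  factor : ∀ p σ y₀ c s → + 2 * p - ((c + c) * σ + y₀ * (s + s)) ≡ (p - (c * σ + y₀ * s)) + (p - (c * σ + y₀ * s))
  factor = solve-∀

-- Halving, exact on even integers.
half : ℤ → ℤ
half (+ n)    = + ℕ.⌊ n /2⌋
half -[1+ n ] = - (+ ℕ.⌊ suc n /2⌋)

half-double : ∀ c → half (c + c) ≡ c
half-double (+ n)    = cong +_ (sym (ℕP.n≡⌊n+n/2⌋ n))
half-double -[1+ n ] = cong (λ t → - (+ suc t)) (sym (ℕP.n≡⌊n+n/2⌋ n))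

half-even : ∀ {z} (e : Even z) → half z ≡ proj₁ e
half-even (c , z≡c+c) = trans (cong half z≡c+c) (half-double c)

even-half : ∀ {z} → Even z → z ≡ half z + half z
even-half e@(c , z≡c+c) = trans z≡c+c (cong (λ h → h + h) (sym (half-even e)))

half-+ : ∀ {a b} → Even a → Even b → half (a + b) ≡ half a + half b
half-+ {a} {b} ea@(c , a≡c+c) eb@(d , b≡d+d) = begin
  half (a + b)             ≡⟨ cong half (cong₂ _+_ a≡c+c b≡d+d) ⟩
  half ((c + c) + (d + d)) ≡⟨ cong half (regroup c d) ⟩
  half ((c + d) + (c + d)) ≡⟨ half-double (c + d) ⟩
  c + d                    ≡⟨ sym (cong₂ _+_ (half-even ea) (half-even eb)) ⟩
  half a + half b ∎
  where
  open ≡-Reasoning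
  regroup : ∀ c d → (c + c) + (d + d) ≡ (c + d) + (c + d)
  regroup = solve-∀

pair-central : ∀ {r} (x : Vecℤ (suc r)) → ⟨ x , centralCochar r ⟩ ≡ x fz * + 2 + sumTail x
pair-central x = cong (_+_ (x fz * + 2)) (sum-cong (λ j → ℤP.*-identityʳ (x (fs j))))

<⇒≡ᵇ-false : ∀ m n → m < n → (m ≡ᵇ n) ≡ false
<⇒≡ᵇ-false zero    (suc n) _         = refl
<⇒≡ᵇ-false (suc m) (suc n) (s≤s m<n) = <⇒≡ᵇ-false m n m<n

last-has-no-next : ∀ r (i j : Fin r) → isLast r i ≡ true → (toℕ j ≡ᵇ suc (toℕ i)) ≡ false
last-has-no-next r i j =
  isLast-cases r i (λ b → b ≡ true → (toℕ j ≡ᵇ suc (toℕ i)) ≡ false)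
    (λ i-last _ → <⇒≡ᵇ-false (toℕ j) (suc (toℕ i)) (subst (toℕ j <_) (sym i-last) (toℕ<n j)))
    (λ _ ())


-- The choice of m only affects the pairing with the central cocharacter.
module HalvingMap (r : ℕ) (m : ℤ) where

  φ : Vecℤ (suc r) → Vecℤ (suc r)
  φ x fz     = m * half (x fz) - half (sumTail x)
  φ x (fs j) = x (fs j) - half (x fz)

  lift : ℤ → Vecℤ (suc r) → Vecℤ (suc r)
  lift h x′ fz     = h + h
  lift h x′ (fs j) = x′ (fs j) + h

  φ-additive : ∀ x y → Y₂ x → Y₂ y → φ (x ⊕ y) ≗ (φ x ⊕ φ y)
  φ-additive x y (ex₀ , exΣ) (ey₀ , eyΣ) fz =
    trans (cong₂ (λ a b → m * a - b) (half-+ ex₀ ey₀) (trans (cong half (sum-⊕ (tl x) (tl y))) (half-+ exΣ eyΣ)))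
      (regroup m (half (x fz)) (half (y fz)) (half (sumTail x)) (half (sumTail y)))
    where
    regroup : ∀ m a b c d → m * (a + b) - (c + d) ≡ (m * a - c) + (m * b - d)
    regroup = solve-∀
  φ-additive x y (ex₀ , _) (ey₀ , _) (fs j) =
    trans (cong (λ a → (x (fs j) + y (fs j)) - a) (half-+ ex₀ ey₀)) (regroup (x (fs j)) (y (fs j)) _ _)
    where
    regroup : ∀ a b c d → (a + b) - (c + d) ≡ (a - c) + (b - d)
    regroup = solve-∀

  φ-central : ∀ x → Y₂ x → ⟨ φ x , centralCochar r ⟩ + + r * half (x fz) ≡ (m + m) * half (x fz)
  φ-central x (_ , exΣ) = begin
    ⟨ φ x , centralCochar r ⟩ + + r * h
      ≡⟨ cong (_+ + r * h) (pair-central (φ x)) ⟩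
    (m * h - hΣ) * + 2 + sumℤ (λ j → x (fs j) + - h) + + r * h
      ≡⟨ cong (λ s → (m * h - hΣ) * + 2 + s + + r * h) (sum-shift (tl x) (- h)) ⟩
    (m * h - hΣ) * + 2 + (sumTail x + + r * - h) + + r * h
      ≡⟨ cong (λ s → (m * h - hΣ) * + 2 + (s + + r * - h) + + r * h) (even-half exΣ) ⟩
    (m * h - hΣ) * + 2 + ((hΣ + hΣ) + + r * - h) + + r * h
      ≡⟨ cancel m h hΣ (+ r) ⟩
    (m + m) * h ∎
    where
    open ≡-Reasoning
    h = half (x fz)
    hΣ = half (sumTail x)
    cancel : ∀ m h hΣ r → (m * h - hΣ) * + 2 + ((hΣ + hΣ) + r * - h) + r * h ≡ (m + m) * h
    cancel = solve-∀

  lift-φ : ∀ x → Y₂ x → lift (half (x fz)) (φ x) ≗ x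
  lift-φ x (ex₀ , _) fz     = sym (even-half ex₀)
  lift-φ x _         (fs j) = cancel (x (fs j)) (half (x fz))
    where
    cancel : ∀ a h → (a - h) + h ≡ a
    cancel = solve-∀

  module _ (h : ℤ) (x′ : Vecℤ (suc r))
           (balanced : ⟨ x′ , centralCochar r ⟩ + + r * h ≡ (m + m) * h) where

    sumTail-lift : sumTail (lift h x′) ≡ (m * h - x′ fz) + (m * h - x′ fz)
    sumTail-lift = begin
      sumTail (lift h x′)                         ≡⟨ sum-shift (tl x′) h ⟩
      sumTail x′ + + r * h                        ≡⟨ isolate (x′ fz) (sumTail x′) (+ r * h) ⟩
      (x′ fz * + 2 + sumTail x′ + + r * h) - x′ fz * + 2
        ≡⟨ cong (λ t → t + + r * h - x′ fz * + 2) (sym (pair-central x′)) ⟩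
      (⟨ x′ , centralCochar r ⟩ + + r * h) - x′ fz * + 2
        ≡⟨ cong (_- x′ fz * + 2) balanced ⟩
      (m + m) * h - x′ fz * + 2                   ≡⟨ split m h (x′ fz) ⟩
      (m * h - x′ fz) + (m * h - x′ fz) ∎
      where
      open ≡-Reasoning
      isolate : ∀ a s t → s + t ≡ (a * + 2 + s + t) - a * + 2
      isolate = solve-∀
      split : ∀ m h a → (m + m) * h - a * + 2 ≡ (m * h - a) + (m * h - a)
      split = solve-∀

    lift-Y₂ : Y₂ (lift h x′)
    lift-Y₂ = (h , refl) , (m * h - x′ fz , sumTail-lift)

    φ-lift : φ (lift h x′) ≗ x′
    φ-lift fz = begin
      m * half (h + h) - half (sumTail (lift h x′))
        ≡⟨ cong₂ (λ a b → m * a - b) (half-double h) (half-even (proj₂ lift-Y₂)) ⟩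
      m * h - (m * h - x′ fz) ≡⟨ cancel (m * h) (x′ fz) ⟩
      x′ fz ∎
      where
      open ≡-Reasoning
      cancel : ∀ a b → a - (a - b) ≡ b
      cancel = solve-∀
    φ-lift (fs j) = trans (cong (λ a → (x′ (fs j) + h) - a) (half-double h)) (cancel (x′ (fs j)) h)
      where
      cancel : ∀ a h → (a + h) - h ≡ a
      cancel = solve-∀

  φ-root : ∀ i → φ ((+ nα r i) • gspCoroot r i) ≗ gspRoot r i
  φ-root i fz = begin
    m * half (+ nα r i * + 0) - half (sumℤ ((+ nα r i) • tl (gspCoroot r i)))
      ≡⟨ cong₂ (λ a b → m * half a - half b) (ℤP.*-zeroʳ (+ nα r i)) (sum-• (+ nα r i) (tl (gspCoroot r i))) ⟩
    m * + 0 - half (+ nα r i * sumTail (gspCoroot r i))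
      ≡⟨ cong₂ (λ a b → a - half b) (ℤP.*-zeroʳ m) (cong₂ (λ n s → + n * s) (scale r i) (sumTail-coroot r i)) ⟩
    + 0 - half (+ (if isLast r i then 2 else 1) * (if isLast r i then + 1 else + 0))
      ≡⟨ evaluate (isLast r i) ⟩
    (if isLast r i then - (+ 1) else + 0) ∎
    where
    open ≡-Reasoning
    evaluate : ∀ b → + 0 - half (+ (if b then 2 else 1) * (if b then + 1 else + 0)) ≡ (if b then - (+ 1) else + 0)
    evaluate true  = refl
    evaluate false = refl
  φ-root i (fs j) =
    trans (cong (λ n → + n * gspCoroot r i (fs j) - half (+ n * + 0)) (scale r i))
      (evaluate (isLast r i) (toℕ j ≡ᵇ toℕ i) (toℕ j ≡ᵇ suc (toℕ i)) (last-has-no-next r i j))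
    where
    evaluate : ∀ b P Q → (b ≡ true → Q ≡ false) →
      + (if b then 2 else 1) * (if P then + 1 else if Q then - (+ 1) else + 0) - half (+ (if b then 2 else 1) * + 0)
        ≡ (if P then (if b then + 2 else + 1) else if Q then - (+ 1) else + 0)
    evaluate true  true  Q     _        = refl
    evaluate true  false Q     no-next  rewrite no-next refl = refl
    evaluate false true  Q     _        = refl
    evaluate false false true  _        = refl
    evaluate false false false _        = refl

  φ-coroot : ∀ i x → Y₂ x → + nα r i * ⟨ gspCoroot r i , φ x ⟩ ≡ + 1 * ⟨ gspRoot r i , x ⟩
  φ-coroot i x (ex₀ , _) =
    trans (cong₂ (λ n v → + n * v) (scale r i) (coroot-pairing r i (φ x)))
      (trans by-lastness (sym (cong (+ 1 *_) (root-pairing r i x))))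
    where
    k = toℕ i
    h = half (x fz)
    a = coord k (tl x)
    b = coord (suc k) (tl x)
    U = coord k (tl (φ x))
    V = coord (suc k) (tl (φ x))
    P : Bool → Set
    P last? = + (if last? then 2 else 1) * (U - V)
            ≡ + 1 * ((if last? then - (+ 1) else + 0) * x fz + ((if last? then + 2 else + 1) * a - b))
    U≡a-h : U ≡ a + - h
    U≡a-h = coord-shift k (tl x) (- h) (toℕ<n i)
    last : ∀ u v b x₀ → u ≡ a + - h → v ≡ + 0 → b ≡ + 0 → x₀ ≡ h + h →
      + 2 * (u - v) ≡ + 1 * (- (+ 1) * x₀ + (+ 2 * a - b))
    last u v b x₀ refl refl refl refl = simplify a h
      where
      simplify : ∀ a h → + 2 * ((a + - h) - + 0) ≡ + 1 * (- (+ 1) * (h + h) + (+ 2 * a - + 0))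
      simplify = solve-∀
    notLast : ∀ u v b x₀ → u ≡ a + - h → v ≡ b + - h → + 1 * (u - v) ≡ + 1 * (+ 0 * x₀ + (+ 1 * a - b))
    notLast u v b x₀ refl refl = simplify a h b x₀
      where
      simplify : ∀ a h b x₀ → + 1 * ((a + - h) - (b + - h)) ≡ + 1 * (+ 0 * x₀ + (+ 1 * a - b))
      simplify = solve-∀
    by-lastness : P (isLast r i)
    by-lastness = isLast-cases r i P
      (λ i-last → last U V b (x fz) U≡a-h (coord-out (suc k) _ (ℕP.≤-reflexive (sym i-last)))
                    (coord-out (suc k) _ (ℕP.≤-reflexive (sym i-last))) (even-half ex₀))
      (λ i<r → notLast U V b (x fz) U≡a-h (coord-shift (suc k) (tl x) (- h) i<r))

  lift-cong : ∀ {h h′ u v} → h ≡ h′ → u ≗ v → lift h u ≗ lift h′ v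
  lift-cong h≡h′ u≗v fz     = cong (λ h → h + h) h≡h′
  lift-cong h≡h′ u≗v (fs j) = cong₂ _+_ (u≗v (fs j)) h≡h′

pair-congˡ : ∀ {k} {u v : Vecℤ k} (w : Vecℤ k) → u ≗ v → ⟨ u , w ⟩ ≡ ⟨ v , w ⟩
pair-congˡ w u≗v = sum-cong (λ j → cong (_* w j) (u≗v j))

isoFromInverse : ∀ {D E} (φ : Vecℤ (ambient D) → Vecℤ (ambient E)) (ψ : Vecℤ (ambient E) → Vecℤ (ambient D))
  (σ : Fin (rank D) ↔ Fin (rank E)) →
  (∀ x → X D x → X E (φ x)) →
  (∀ x y → X D x → X D y → φ (x ⊕ y) ≗ (φ x ⊕ φ y)) →
  (∀ x′ → X E x′ → X D (ψ x′)) →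
  (∀ {u v} → u ≗ v → ψ u ≗ ψ v) →
  (∀ x → X D x → ψ (φ x) ≗ x) →
  (∀ x′ → X E x′ → φ (ψ x′) ≗ x′) →
  (∀ i → φ (simpleRoot D i) ≗ simpleRoot E (Inverse.to σ i)) →
  (∀ i x → X D x → (+ corootDen D i) * ⟨ corootNum E (Inverse.to σ i) , φ x ⟩
                     ≡ (+ corootDen E (Inverse.to σ i)) * ⟨ corootNum D i , x ⟩) →
  D ≅ E
isoFromInverse φ ψ σ into additive ψ-into ψ-cong ψ∘φ φ∘ψ roots coroots = record
  { φ       = φ
  ; σ       = σ
  ; φ-into  = into
  ; φ-add   = additive
  ; φ-inj   = λ x y x∈X y∈X φx≗φy j →
      trans (sym (ψ∘φ x x∈X j)) (trans (ψ-cong φx≗φy j) (ψ∘φ y y∈X j))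
  ; φ-surj  = λ x′ x′∈X → ψ x′ , ψ-into x′ x′∈X , φ∘ψ x′ x′∈X
  ; roots   = roots
  ; coroots = coroots
  }

-- r = 2m + 1: the dual datum is that of GSp_{2r}.  Here x_0/2 is recovered
-- from φ(x) as −⟨φ(x), z⟩.
module OddCase (r′ : ℕ) (m : ℤ) (r-odd : + suc r′ ≡ + 1 + (m + m)) where
  r = suc r′
  open HalvingMap r m

  ψ : Vecℤ (suc r) → Vecℤ (suc r)
  ψ x′ = lift (- ⟨ x′ , centralCochar r ⟩) x′

  balanced : ∀ p → p + + r * (- p) ≡ (m + m) * (- p)
  balanced p = trans (cong (λ t → p + t * - p) r-odd) (simplify p m)
    where
    simplify : ∀ p m → p + (+ 1 + (m + m)) * (- p) ≡ (m + m) * (- p)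
    simplify = solve-∀

  recover-half : ∀ x → Y₂ x → - ⟨ φ x , centralCochar r ⟩ ≡ half (x fz)
  recover-half x x∈Y = solve-for (⟨ φ x , centralCochar r ⟩) (half (x fz)) m
    (trans (cong (λ t → ⟨ φ x , centralCochar r ⟩ + t * half (x fz)) (sym r-odd)) (φ-central x x∈Y))
    where
    solve-for : ∀ p h m → p + (+ 1 + (m + m)) * h ≡ (m + m) * h → - p ≡ h
    solve-for p h m e = trans (isolate p h m) (trans (cong (λ t → (m + m) * h - t + h) e) (cancel h m))
      where
      isolate : ∀ p h m → - p ≡ (m + m) * h - (p + (+ 1 + (m + m)) * h) + h
      isolate = solve-∀
      cancel : ∀ h m → (m + m) * h - (m + m) * h + h ≡ h
      cancel = solve-∀

  iso : DualDatum (+ 0) (+ 1) 2 r ≅ GSpDatum r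
  iso = isoFromInverse φ ψ (↔-id (Fin r))
    (λ _ _ → tt)
    (λ x y x∈Y y∈Y → φ-additive x y (YQ2⇒Y₂ r′ x x∈Y) (YQ2⇒Y₂ r′ y y∈Y))
    (λ x′ _ → Y₂⇒YQ2 r (ψ x′) (lift-Y₂ _ x′ (balanced _)))
    (λ {u} u≗v → lift-cong (cong -_ (pair-congˡ (centralCochar r) u≗v)) u≗v)
    (λ x x∈Y j → trans (lift-cong (recover-half x (YQ2⇒Y₂ r′ x x∈Y)) (λ _ → refl) j)
                       (lift-φ x (YQ2⇒Y₂ r′ x x∈Y) j))
    (λ x′ _ → φ-lift _ x′ (balanced _))
    φ-root
    (λ i x x∈Y → φ-coroot i x (YQ2⇒Y₂ r′ x x∈Y))

-- r = 2m: φ(x) is orthogonal to z, i.e. lies in the character lattice of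
-- PGSp_{2r}, and x_0/2 is carried by the extra G_m coordinate.
module EvenCase (r′ : ℕ) (m : ℤ) (r-even : + suc r′ ≡ m + m) where
  r = suc r′
  open HalvingMap r m

  φ̂ : Vecℤ (suc r) → Vecℤ (suc (suc r))
  φ̂ x fz     = half (x fz)
  φ̂ x (fs j) = φ x j

  ψ̂ : Vecℤ (suc (suc r)) → Vecℤ (suc r)
  ψ̂ x′ = lift (x′ fz) (tl x′)

  balanced : ∀ x′ → ⟨ tl x′ , centralCochar r ⟩ ≡ + 0 →
    ⟨ tl x′ , centralCochar r ⟩ + + r * x′ fz ≡ (m + m) * x′ fz
  balanced x′ x′⊥z = trans (cong₂ (λ p t → p + t * x′ fz) x′⊥z r-even) (ℤP.+-identityˡ _)

  φ⊥z : ∀ x → Y₂ x → ⟨ φ x , centralCochar r ⟩ ≡ + 0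
  φ⊥z x x∈Y = cancel ⟨ φ x , centralCochar r ⟩ (+ r * half (x fz))
    (trans (φ-central x x∈Y) (cong (_* half (x fz)) (sym r-even)))
    where
    cancel : ∀ p t → p + t ≡ t → p ≡ + 0
    cancel p t e = trans (isolate p t) (trans (cong (_- t) e) (ℤP.+-inverseʳ t))
      where
      isolate : ∀ p t → p ≡ (p + t) - t
      isolate = solve-∀

  iso : DualDatum (+ 0) (+ 1) 2 r ≅ PGSpGmDatum r
  iso = isoFromInverse φ̂ ψ̂ (↔-id (Fin r))
    (λ x x∈Y → φ⊥z x (YQ2⇒Y₂ r′ x x∈Y))
    (λ x y x∈Y y∈Y → additive (YQ2⇒Y₂ r′ x x∈Y) (YQ2⇒Y₂ r′ y y∈Y))
    (λ x′ x′⊥z → Y₂⇒YQ2 r (ψ̂ x′) (lift-Y₂ _ (tl x′) (balanced x′ x′⊥z)))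
    (λ u≗v → lift-cong (u≗v fz) (λ j → u≗v (fs j)))
    (λ x x∈Y → lift-φ x (YQ2⇒Y₂ r′ x x∈Y))
    (λ x′ x′⊥z → inverse x′ x′⊥z)
    roots
    (λ i x x∈Y → trans (cong (+ nα r i *_) (ℤP.+-identityˡ _)) (φ-coroot i x (YQ2⇒Y₂ r′ x x∈Y)))
    where
    additive : ∀ {x y} → Y₂ x → Y₂ y → φ̂ (x ⊕ y) ≗ (φ̂ x ⊕ φ̂ y)
    additive (ex₀ , _)   (ey₀ , _)   fz     = half-+ ex₀ ey₀
    additive {x} {y} x∈Y y∈Y (fs j) = φ-additive x y x∈Y y∈Y j
    inverse : ∀ x′ → ⟨ tl x′ , centralCochar r ⟩ ≡ + 0 → φ̂ (ψ̂ x′) ≗ x′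
    inverse x′ _      fz     = half-double (x′ fz)
    inverse x′ x′⊥z   (fs j) = φ-lift _ (tl x′) (balanced x′ x′⊥z) j
    roots : ∀ i → φ̂ ((+ nα r i) • gspCoroot r i) ≗ extGm (gspRoot r i)
    roots i fz     = cong half (ℤP.*-zeroʳ (+ nα r i))
    roots i (fs j) = φ-root i j

parity-split : ∀ r → + r ≡ + (r % 2) + (+ (r div 2) + + (r div 2))
parity-split r = begin
  + r                                   ≡⟨ cong +_ (m≡m%n+[m/n]*n r 2) ⟩
  + (r % 2 ℕ.+ r div 2 ℕ.* 2)          ≡⟨ ℤP.pos-+ (r % 2) (r div 2 ℕ.* 2) ⟩
  + (r % 2) + + (r div 2 ℕ.* 2)        ≡⟨ cong (_+_ (+ (r % 2))) (ℤP.pos-* (r div 2) 2) ⟩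
  + (r % 2) + + (r div 2) * + 2        ≡⟨ cong (_+_ (+ (r % 2))) (twice (+ (r div 2))) ⟩
  + (r % 2) + (+ (r div 2) + + (r div 2)) ∎
  where
  open ≡-Reasoning
  twice : ∀ q → q * + 2 ≡ q + q
  twice = solve-∀

proposition2p6 : (r : ℕ) → 1 ≤ r →
    (r % 2 ≡ 1 → DualDatum (+ 0) (+ 1) 2 r ≅ GSpDatum r)
    × (r % 2 ≡ 0 → DualDatum (+ 0) (+ 1) 2 r ≅ PGSpGmDatum r)
proposition2p6 (suc r′) _ = odd , even
  where
  r = suc r′
  m = + (r div 2)
  odd : r % 2 ≡ 1 → DualDatum (+ 0) (+ 1) 2 r ≅ GSpDatum r
  odd r%2≡1 = OddCase.iso r′ m (trans (parity-split r) (cong (λ e → + e + (m + m)) r%2≡1))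
  even : r % 2 ≡ 0 → DualDatum (+ 0) (+ 1) 2 r ≅ PGSpGmDatum r
  even r%2≡0 = EvenCase.iso r′ m
    (trans (parity-split r) (trans (cong (λ e → + e + (m + m)) r%2≡0) (ℤP.+-identityˡ (m + m))))
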